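{- For $n\ge3$, $\operatorname{th_{dim}}(C_n)=2\sqrt{\tfrac{2}{3}n}\,(1\pm o(1))$ as $n\to\infty$; that is, $\operatorname{th_{dim}}(C_n)/\bigl(2\sqrt{2n/3}\bigr)\to 1$.
   Context: $C_n$ is the cycle on $n$ vertices. $\operatorname{dist}(u,v)$ is the shortest-path distance. For a nonnegative integer $r$, $\operatorname{dist}_r(x,v)=\min(\operatorname{dist}(x,v),r+1)$. A set $S\subseteq V(G)$ is a distance-$r$ resolving set if for all distinct $x,y\in V(G)$ there is $v\in S$ with $\operatorname{dist}_r(v,x)\ne\operatorname{dist}_r(v,y)$. $\dim_r(G)$ is the minimum size of such a set and $\operatorname{th_{dim}}(G)=\min_{r\ge0}(r+\dim_r(G))$ over nonnegative integers $r$. -}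

module Defs where

open import Data.Nat using (ℕ; zero; suc; _+_; _⊓_; _∸_; _≤_; ∣_-_∣)
open import Data.Fin using (Fin; toℕ)
open import Data.Fin.Subset using (Subset; _∈_; ∣_∣)
open import Data.Product using (Σ; ∃; _×_)
open import Relation.Binary.PropositionalEquality using (_≡_; _≢_)
open import Data.Integer using (+_)
import Data.Rational as ℚ
open ℚ using (ℚ)

-- Shortest-path distance in the cycle C_n on vertex set Fin n = {0,…,n-1},
-- where i is adjacent to i±1 (mod n):  dist(u,v) = min(|u-v|, n-|u-v|).
cdist : (n : ℕ) → Fin n → Fin n → ℕ
cdist n u v = ∣ toℕ u - toℕ v ∣ ⊓ (n ∸ ∣ toℕ u - toℕ v ∣)

cdist-r : (n r : ℕ) → Fin n → Fin n → ℕ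
cdist-r n r x v = cdist n x v ⊓ suc r

Resolving : (n r : ℕ) → Subset n → Set
Resolving n r S =
  ∀ (x y : Fin n) → x ≢ y → ∃ λ (v : Fin n) → v ∈ S × (cdist-r n r v x ≢ cdist-r n r v y)

IsDim : (n r d : ℕ) → Set
IsDim n r d =
  (∃ λ (S : Subset n) → Resolving n r S × ∣ S ∣ ≡ d)
  × (∀ (S : Subset n) → Resolving n r S → d ≤ ∣ S ∣)

-- t = th_dim(C_n) = min over r ≥ 0 of (r + dim_r(C_n)).
IsThDim : (n t : ℕ) → Set
IsThDim n t =
  (∃ λ (r : ℕ) → ∃ λ (d : ℕ) → IsDim n r d × r + d ≡ t)
  × (∀ (r d : ℕ) → IsDim n r d → t ≤ r + d)

ℕ→ℚ : ℕ → ℚ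
ℕ→ℚ k = (+ k) ℚ./ 1

{-# OPTIONS --safe #-}
-- Let S be a distance-r resolving set of C_n.  Give every vertex x two codes, each
-- a landmark seeing x (within distance r) plus a slot of that landmark: if two landmarks see x,
-- their signed offsets to x; if only v sees x, its offset and the bare distance dist(v,x), which
-- determines x since two vertices seen only by v at equal distance would not be resolved; the
-- at most one vertex that no landmark sees takes two spare codes.  All 2n codes differ and each
-- landmark has 3(r+1) slots, so 2n ≤ 3(r+1)|S| + 2; with 4r|S| ≤ (r+|S|)² this gives
-- 8n ≤ 3t² + O(t) for t = r + |S|.
--
-- For r = 2s and 6s² ≤ n < 6(s+1)², cut C_n into at most s+2 blocks of length at
-- most 3r+1, with landmarks at the start of each block and 2r further on.  Every vertex x lies at
-- some distance j ≤ r from a landmark a, and the only other vertex at distance j from a is the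
-- reflection of x in a.  A landmark c next to a, at distance h ≤ r+1, lies at distances h+j and
-- |h-j| ≤ r from these two, so it separates them.  Hence t ≤ 2s + 2(s+2): 3t² ≤ 8n + O(√n).
module Submission where

open import Defs

module _ where
  open import Data.Bool using (true; false)
  open import Data.Empty using (⊥-elim)
  open import Data.Fin as Fin using (Fin; toℕ; fromℕ<; combine; join; splitAt)
  open import Data.Fin.Patterns using (0F; 1F; 2F)
  open import Data.Fin.Properties as Fin
    using ( toℕ<n; toℕ-injective; toℕ-fromℕ<; fromℕ<-injective; combine-injective
          ; join-splitAt; splitAt-join; injective⇒≤; any?; all?)
  open import Data.Fin.Subset using (Subset; _∈_; ∣_∣; _∪_; ⁅_⁆; ⊥)
  open import Data.Fin.Subset.Properties using (x∈p∪q⁺; x∈⁅x⁆; ∣⊥∣≡0; ∣⁅x⁆∣≡1; _∈?_; anySubset?)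
  open import Data.Nat
  open import Data.Nat.DivMod using (_/_; _%_; m≡m%n+[m/n]*n; m%n<n; m<n*o⇒m/o<n)
  open import Data.Nat.Properties
  open import Algebra.Properties.CommutativeSemigroup +-commutativeSemigroup using (xy∙z≈xz∙y)
  open import Data.Nat.Tactic.RingSolver using (solve-∀)
  open import Data.Product using (∃; _×_; _,_; proj₁; proj₂)
  open import Data.Sum using (_⊎_; inj₁; inj₂; swap; [_,_]′; map₁)
  open import Data.Sum.Properties using (inj₁-injective; inj₂-injective)
  open import Data.Vec.Base using (_∷_; []; here; there)
  open import Function using (_∘_)
  open import Function.Definitions using (Injective)
  open import Relation.Nullary using (¬_; Dec; yes; no; ¬?; contradiction)
  open import Relation.Nullary.Decidable using (_×-dec_; _→-dec_)
  open import Relation.Binary.PropositionalEquality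

  private variable
    n r d e h j k m : ℕ
    S : Subset n
    a c x z : Fin n

  -- Distances along the cycle

  wrapDist : ℕ → ℕ → ℕ
  wrapDist n δ = δ ⊓ (n ∸ δ)

  wrapDist-short : d + d ≤ n → wrapDist n d ≡ d
  wrapDist-short {d} {n} dd = m≤n⇒m⊓n≡m (subst (_≤ n ∸ d) (m+n∸n≡m d d) (∸-monoˡ-≤ d dd))

  wrapDist-complement : d ≤ n → wrapDist n (n ∸ d) ≡ wrapDist n d
  wrapDist-complement {d} {n} d≤n = begin
    (n ∸ d) ⊓ (n ∸ (n ∸ d)) ≡⟨ cong ((n ∸ d) ⊓_) (m∸[m∸n]≡n d≤n) ⟩
    (n ∸ d) ⊓ d             ≡⟨ ⊓-comm (n ∸ d) d ⟩
    d ⊓ (n ∸ d)             ∎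
    where open ≡-Reasoning

  cdist-comm : (u v : Fin n) → cdist n u v ≡ cdist n v u
  cdist-comm {n} u v = cong (wrapDist n) (∣-∣-comm (toℕ u) (toℕ v))

  data Arc {n} (u : Fin n) (d : ℕ) (v : Fin n) : Set where
    direct  : toℕ u + d ≡ toℕ v → Arc u d v
    wrapped : toℕ u + d ≡ toℕ v + n → Arc u d v

  toℕ≢+n : ∀ (v : Fin n) k → toℕ v ≢ k + n
  toℕ≢+n {n} v k eq = <⇒≱ (toℕ<n v) (subst (n ≤_) (sym eq) (m≤n+m n k))

  arc-target-unique : {u v w : Fin n} → Arc u d v → Arc u d w → v ≡ w
  arc-target-unique (direct p) (direct q) = toℕ-injective (trans (sym p) q)
  arc-target-unique {v = v} (direct p) (wrapped q) = ⊥-elim (toℕ≢+n v _ (trans (sym p) q))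
  arc-target-unique {w = w} (wrapped p) (direct q) = ⊥-elim (toℕ≢+n w _ (trans (sym q) p))
  arc-target-unique {n} (wrapped p) (wrapped q) = toℕ-injective (+-cancelʳ-≡ n _ _ (trans (sym p) q))

  arc-source-unique : {u v w : Fin n} → Arc u d w → Arc v d w → u ≡ v
  arc-source-unique {d = d} (direct p) (direct q) = toℕ-injective (+-cancelʳ-≡ d _ _ (trans p (sym q)))
  arc-source-unique {n} {d} {u} {v} (direct p) (wrapped q) =
    ⊥-elim (toℕ≢+n v (toℕ u) (+-cancelʳ-≡ d _ _ (trans q (trans (cong (_+ n) (sym p)) (xy∙z≈xz∙y (toℕ u) d n)))))
  arc-source-unique {n} {d} {u} {v} (wrapped p) (direct q) =
    ⊥-elim (toℕ≢+n u (toℕ v) (+-cancelʳ-≡ d _ _ (trans p (trans (cong (_+ n) (sym q)) (xy∙z≈xz∙y (toℕ v) d n)))))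
  arc-source-unique {d = d} (wrapped p) (wrapped q) = toℕ-injective (+-cancelʳ-≡ d _ _ (trans p (sym q)))

  arc-refl : (u : Fin n) → Arc u 0 u
  arc-refl u = direct (+-identityʳ (toℕ u))

  cdist-arc : {u v : Fin n} → d + d ≤ n → Arc u d v → cdist n u v ≡ d
  cdist-arc {n} {d} {u} {v} dd (direct p) = begin
    wrapDist n ∣ toℕ u - toℕ v ∣       ≡⟨ cong (λ b → wrapDist n ∣ toℕ u - b ∣) (sym p) ⟩
    wrapDist n ∣ toℕ u - toℕ u + d ∣   ≡⟨ cong (wrapDist n) (∣m-m+n∣≡n (toℕ u) d) ⟩
    wrapDist n d                       ≡⟨ wrapDist-short dd ⟩
    d                                  ∎
    where open ≡-Reasoning
  cdist-arc {n} {d} {u} {v} dd (wrapped p) = begin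
    wrapDist n ∣ toℕ u - toℕ v ∣             ≡⟨ cong (λ a → wrapDist n ∣ a - toℕ v ∣) u≡ ⟩
    wrapDist n ∣ toℕ v + (n ∸ d) - toℕ v ∣   ≡⟨ cong (wrapDist n) (∣-∣-comm (toℕ v + (n ∸ d)) (toℕ v)) ⟩
    wrapDist n ∣ toℕ v - toℕ v + (n ∸ d) ∣   ≡⟨ cong (wrapDist n) (∣m-m+n∣≡n (toℕ v) (n ∸ d)) ⟩
    wrapDist n (n ∸ d)                       ≡⟨ wrapDist-complement d≤n ⟩
    wrapDist n d                             ≡⟨ wrapDist-short dd ⟩
    d                                        ∎
    where
    open ≡-Reasoning
    d≤n : d ≤ n
    d≤n = ≤-trans (m≤m+n d d) dd
    u≡ : toℕ u ≡ toℕ v + (n ∸ d)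
    u≡ = +-cancelʳ-≡ d _ _ (begin
      toℕ u + d             ≡⟨ p ⟩
      toℕ v + n             ≡⟨ cong (toℕ v +_) (m∸n+n≡m d≤n) ⟨
      toℕ v + (n ∸ d + d)   ≡⟨ +-assoc (toℕ v) (n ∸ d) d ⟨
      toℕ v + (n ∸ d) + d   ∎)

  arc-cdist-≤ : (u v : Fin n) → toℕ u ≤ toℕ v → Arc u (cdist n u v) v ⊎ Arc v (cdist n u v) u
  arc-cdist-≤ {n} u v u≤v rewrite m≤n⇒∣m-n∣≡n∸m u≤v with ⊓-sel δ (n ∸ δ)
    where δ = toℕ v ∸ toℕ u
  ... | inj₁ eq rewrite eq = inj₁ (direct (m+[n∸m]≡n u≤v))
  ... | inj₂ eq rewrite eq = inj₂ (wrapped (begin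
    toℕ v + (n ∸ δ)          ≡⟨ cong (_+ (n ∸ δ)) (m+[n∸m]≡n u≤v) ⟨
    toℕ u + δ + (n ∸ δ)      ≡⟨ +-assoc (toℕ u) δ (n ∸ δ) ⟩
    toℕ u + (δ + (n ∸ δ))    ≡⟨ cong (toℕ u +_) (m+[n∸m]≡n δ≤n) ⟩
    toℕ u + n                ∎))
    where
    open ≡-Reasoning
    δ = toℕ v ∸ toℕ u
    δ≤n : δ ≤ n
    δ≤n = ≤-trans (m∸n≤m (toℕ v) (toℕ u)) (<⇒≤ (toℕ<n v))

  arc-cdist : (u v : Fin n) → Arc u (cdist n u v) v ⊎ Arc v (cdist n u v) u
  arc-cdist {n} u v with ≤-total (toℕ u) (toℕ v)
  ... | inj₁ u≤v = arc-cdist-≤ u v u≤v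
  ... | inj₂ v≤u = swap (subst (λ k → Arc v k u ⊎ Arc u k v) (cdist-comm v u) (arc-cdist-≤ v u v≤u))

  arc-trans : {u v w : Fin n} → d + e ≤ n → Arc u d v → Arc v e w → Arc u (d + e) w
  arc-trans {d = d} {e} {u} _ (direct p) (direct q) = direct (trans (sym (+-assoc (toℕ u) d e)) (trans (cong (_+ e) p) q))
  arc-trans {d = d} {e} {u} _ (direct p) (wrapped q) = wrapped (trans (sym (+-assoc (toℕ u) d e)) (trans (cong (_+ e) p) q))
  arc-trans {n} {d} {e} {u} {v} _ (wrapped p) (direct q) = wrapped (begin
    toℕ u + (d + e)  ≡⟨ +-assoc (toℕ u) d e ⟨
    toℕ u + d + e    ≡⟨ cong (_+ e) p ⟩
    toℕ v + n + e    ≡⟨ xy∙z≈xz∙y (toℕ v) n e ⟩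
    toℕ v + e + n    ≡⟨ cong (_+ n) q ⟩
    _                ∎)
    where open ≡-Reasoning
  arc-trans {n} {d} {e} {u} {v} {w} d+e≤n (wrapped p) (wrapped q) = ⊥-elim (<⇒≱ (+-mono-<-≤ (toℕ<n u) d+e≤n) (begin
    n + n                ≤⟨ +-monoˡ-≤ n (m≤n+m n (toℕ w)) ⟩
    toℕ w + n + n        ≡⟨ cong (_+ n) q ⟨
    toℕ v + e + n        ≡⟨ xy∙z≈xz∙y (toℕ v) e n ⟩
    toℕ v + n + e        ≡⟨ cong (_+ e) p ⟨
    toℕ u + d + e        ≡⟨ +-assoc (toℕ u) d e ⟩
    toℕ u + (d + e)      ∎))
    where open ≤-Reasoning

  arc-cancelʳ : {u v w : Fin n} → e ≤ d → Arc u d w → Arc v e w → Arc u (d ∸ e) v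
  arc-cancelʳ {n} {e} {d} {u} {v} {w} e≤d = cancel
    where
    shift : toℕ u + (d ∸ e) + e ≡ toℕ u + d
    shift = trans (+-assoc (toℕ u) (d ∸ e) e) (cong (toℕ u +_) (m∸n+n≡m e≤d))
    cancel : Arc u d w → Arc v e w → Arc u (d ∸ e) v
    cancel (direct p) (direct q) = direct (+-cancelʳ-≡ e _ _ (trans shift (trans p (sym q))))
    cancel (wrapped p) (wrapped q) = direct (+-cancelʳ-≡ e _ _ (trans shift (trans p (sym q))))
    cancel (wrapped p) (direct q) = wrapped (+-cancelʳ-≡ e _ _ (begin
      toℕ u + (d ∸ e) + e   ≡⟨ trans shift p ⟩
      toℕ w + n             ≡⟨ cong (_+ n) q ⟨
      toℕ v + e + n         ≡⟨ xy∙z≈xz∙y (toℕ v) e n ⟩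
      toℕ v + n + e         ∎))
      where open ≡-Reasoning
    cancel (direct p) (wrapped q) = ⊥-elim (toℕ≢+n v (toℕ u + (d ∸ e)) (+-cancelʳ-≡ e _ _ (begin
      toℕ v + e                 ≡⟨ q ⟩
      toℕ w + n                 ≡⟨ cong (_+ n) (trans shift p) ⟨
      toℕ u + (d ∸ e) + e + n   ≡⟨ xy∙z≈xz∙y (toℕ u + (d ∸ e)) e n ⟩
      toℕ u + (d ∸ e) + n + e   ∎)))
      where open ≡-Reasoning

  arc-cancelˡ : {u v w : Fin n} → e ≤ d → Arc u e v → Arc u d w → Arc v (d ∸ e) w
  arc-cancelˡ {n} {e} {d} {u} {v} {w} e≤d = cancel
    where
    shift : toℕ u + e + (d ∸ e) ≡ toℕ u + d
    shift = trans (+-assoc (toℕ u) e (d ∸ e)) (cong (toℕ u +_) (m+[n∸m]≡n e≤d))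
    cancel : Arc u e v → Arc u d w → Arc v (d ∸ e) w
    cancel (direct p) (direct q) = direct (trans (cong (_+ (d ∸ e)) (sym p)) (trans shift q))
    cancel (direct p) (wrapped q) = wrapped (trans (cong (_+ (d ∸ e)) (sym p)) (trans shift q))
    cancel (wrapped p) (wrapped q) = direct (+-cancelʳ-≡ n _ _ (begin
      toℕ v + (d ∸ e) + n   ≡⟨ xy∙z≈xz∙y (toℕ v) (d ∸ e) n ⟩
      toℕ v + n + (d ∸ e)   ≡⟨ cong (_+ (d ∸ e)) p ⟨
      toℕ u + e + (d ∸ e)   ≡⟨ trans shift q ⟩
      toℕ w + n             ∎))
      where open ≡-Reasoning
    cancel (wrapped p) (direct q) = ⊥-elim (toℕ≢+n w (toℕ v + (d ∸ e)) (begin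
      toℕ w                 ≡⟨ trans shift q ⟨
      toℕ u + e + (d ∸ e)   ≡⟨ cong (_+ (d ∸ e)) p ⟩
      toℕ v + n + (d ∸ e)   ≡⟨ xy∙z≈xz∙y (toℕ v) n (d ∸ e) ⟩
      toℕ v + (d ∸ e) + n   ∎))
      where open ≡-Reasoning

  private
    double-≤ : ∀ {a b} → a ≤ b → b + b ≤ n → a + a ≤ n
    double-≤ a≤b = ≤-trans (+-mono-≤ a≤b a≤b)

  cdist-trans : {u v w : Fin n} → (d + e) + (d + e) ≤ n → Arc u d v → Arc v e w → cdist n u w ≡ d + e
  cdist-trans {d = d} {e} {u} short p q = cdist-arc {u = u} short (arc-trans (≤-trans (m≤m+n (d + e) (d + e)) short) p q)

  cdist-converging : {u v w : Fin n} → (d + e) + (d + e) ≤ n → Arc u d w → Arc v e w → cdist n u v ≡ ∣ d - e ∣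
  cdist-converging {n} {d} {e} {u} {v} short p q with ≤-total e d
  ... | inj₁ e≤d = begin
    cdist n u v   ≡⟨ cdist-arc (double-≤ (≤-trans (m∸n≤m d e) (m≤m+n d e)) short) (arc-cancelʳ e≤d p q) ⟩
    d ∸ e         ≡⟨ m≤n⇒∣n-m∣≡n∸m e≤d ⟨
    ∣ d - e ∣     ∎
    where open ≡-Reasoning
  ... | inj₂ d≤e = begin
    cdist n u v   ≡⟨ cdist-comm u v ⟩
    cdist n v u   ≡⟨ cdist-arc (double-≤ (≤-trans (m∸n≤m e d) (m≤n+m e d)) short) (arc-cancelʳ d≤e q p) ⟩
    e ∸ d         ≡⟨ m≤n⇒∣m-n∣≡n∸m d≤e ⟨
    ∣ d - e ∣     ∎
    where open ≡-Reasoning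

  cdist-diverging : {u v w : Fin n} → (d + e) + (d + e) ≤ n → Arc w d u → Arc w e v → cdist n u v ≡ ∣ d - e ∣
  cdist-diverging {n} {d} {e} {u} {v} short p q with ≤-total e d
  ... | inj₁ e≤d = begin
    cdist n u v   ≡⟨ cdist-comm u v ⟩
    cdist n v u   ≡⟨ cdist-arc (double-≤ (≤-trans (m∸n≤m d e) (m≤m+n d e)) short) (arc-cancelˡ e≤d q p) ⟩
    d ∸ e         ≡⟨ m≤n⇒∣n-m∣≡n∸m e≤d ⟨
    ∣ d - e ∣     ∎
    where open ≡-Reasoning
  ... | inj₂ d≤e = begin
    cdist n u v   ≡⟨ cdist-arc (double-≤ (≤-trans (m∸n≤m e d) (m≤n+m e d)) short) (arc-cancelˡ d≤e p q) ⟩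
    e ∸ d         ≡⟨ m≤n⇒∣m-n∣≡n∸m d≤e ⟨
    ∣ d - e ∣     ∎
    where open ≡-Reasoning

  cdist-self : (u : Fin n) → cdist n u u ≡ 0
  cdist-self u = cdist-arc {u = u} z≤n (arc-refl u)

  cdist≡0⇒≡ : (u v : Fin n) → cdist n u v ≡ 0 → u ≡ v
  cdist≡0⇒≡ u v eq with arc-cdist u v
  ... | inj₁ p = arc-target-unique (arc-refl u) (subst (λ k → Arc u k v) eq p)
  ... | inj₂ p = sym (arc-source-unique (subst (λ k → Arc v k u) eq p) (arc-refl u))

  -- Anchored vertices

  truncation-injective : k ≤ r → m ⊓ suc r ≡ k ⊓ suc r → m ≡ k
  truncation-injective {k} {r} {m} k≤r eq = from-sel (⊓-sel m (suc r))
    where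
    eq′ : m ⊓ suc r ≡ k
    eq′ = trans eq (m≤n⇒m⊓n≡m (m≤n⇒m≤1+n k≤r))
    from-sel : m ⊓ suc r ≡ m ⊎ m ⊓ suc r ≡ suc r → m ≡ k
    from-sel (inj₁ m⊓≡m) = trans (sym m⊓≡m) eq′
    from-sel (inj₂ m⊓≡1+r) = ⊥-elim (<⇒≱ (s≤s k≤r) (≤-reflexive (trans (sym m⊓≡1+r) eq′)))

  ∣m-n∣<m+n : ∀ {m n} → 1 ≤ m → 1 ≤ n → ∣ m - n ∣ < m + n
  ∣m-n∣<m+n {m} {n} 1≤m 1≤n with ∣m-n∣≡[m∸n]∨[n∸m] m n
  ... | inj₁ eq = subst (_< m + n) (sym eq) (≤-<-trans (m∸n≤m m n) (m<m+n m 1≤n))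
  ... | inj₂ eq = subst (_< m + n) (sym eq) (≤-<-trans (m∸n≤m n m) (m<n+m n 1≤m))

  ∣m-n∣≤r : ∀ {m n} → m ≤ suc r → 1 ≤ n → n ≤ r → ∣ m - n ∣ ≤ r
  ∣m-n∣≤r {r} {m} {n} m≤1+r 1≤n n≤r with ∣m-n∣≡[m∸n]∨[n∸m] m n
  ... | inj₁ eq = subst (_≤ r) (sym eq) (≤-trans (∸-monoʳ-≤ m 1≤n) (∸-monoˡ-≤ 1 m≤1+r))
  ... | inj₂ eq = subst (_≤ r) (sym eq) (≤-trans (m∸n≤m n m) n≤r)

  Separated : (n r : ℕ) → Subset n → Fin n → Fin n → Set
  Separated n r S x y = ∃ λ v → v ∈ S × cdist-r n r v x ≢ cdist-r n r v y

  separated-sym : Separated n r S x z → Separated n r S z x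
  separated-sym (v , v∈S , differ) = v , v∈S , differ ∘ sym

  Anchored : (n r : ℕ) → Subset n → Fin n → Set
  Anchored n r S x = ∃ λ a → a ∈ S × cdist n a x ≤ r ×
    (∀ z → z ≢ x → cdist n a z ≡ cdist n a x → Separated n r S x z)

  anchored⇒resolving : (∀ x → Anchored n r S x) → Resolving n r S
  anchored⇒resolving {n} {r} anchored x y x≢y with anchored x
  ... | a , a∈S , ax≤r , mirror with cdist n a y ≟ cdist n a x
  ...   | yes same = mirror y (x≢y ∘ sym) same
  ...   | no differ = a , a∈S , differ ∘ truncation-injective ax≤r ∘ sym

  separated-by-distances : c ∈ S → 1 ≤ h → 1 ≤ j → ∣ h - j ∣ ≤ r →
                           cdist n c x ≡ h + j → cdist n c z ≡ ∣ h - j ∣ → Separated n r S x z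
  separated-by-distances {c = c} c∈S 1≤h 1≤j ∣h-j∣≤r cx cz = c , c∈S , λ eq →
    <⇒≢ (∣m-n∣<m+n 1≤h 1≤j) (sym (trans (sym cx) (truncation-injective ∣h-j∣≤r (trans eq (cong (_⊓ _) cz)))))

  landmark-anchored : {x : Fin n} → x ∈ S → Anchored n r S x
  landmark-anchored {r = r} {x = x} x∈S = x , x∈S , subst (_≤ r) (sym (cdist-self x)) z≤n ,
    λ z z≢x same → ⊥-elim (z≢x (sym (cdist≡0⇒≡ x z (trans same (cdist-self x)))))

  anchored-ahead : {a x : Fin n} → a ∈ S → j ≤ r → j + j ≤ n → Arc a j x →
                   (∀ z → Arc z j a → Separated n r S x z) → Anchored n r S x
  anchored-ahead {n} {j = j} {r} {a} {x} a∈S j≤r short ax separate =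
    a , a∈S , subst (_≤ r) (sym ax≡j) j≤r , mirror
    where
    ax≡j : cdist n a x ≡ j
    ax≡j = cdist-arc short ax
    mirror : ∀ z → z ≢ x → cdist n a z ≡ cdist n a x → Separated n r _ x z
    mirror z z≢x same with arc-cdist a z | trans same ax≡j
    ... | inj₁ az | refl = ⊥-elim (z≢x (arc-target-unique az ax))
    ... | inj₂ za | refl = separate z za

  anchored-behind : {a x : Fin n} → a ∈ S → j ≤ r → j + j ≤ n → Arc x j a →
                    (∀ z → Arc a j z → Separated n r S x z) → Anchored n r S x
  anchored-behind {n} {j = j} {r} {a} {x} a∈S j≤r short xa separate =
    a , a∈S , subst (_≤ r) (sym ax≡j) j≤r , mirror
    where
    ax≡j : cdist n a x ≡ j
    ax≡j = trans (cdist-comm a x) (cdist-arc short xa)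
    mirror : ∀ z → z ≢ x → cdist n a z ≡ cdist n a x → Separated n r _ x z
    mirror z z≢x same with arc-cdist a z | trans same ax≡j
    ... | inj₁ az | refl = separate z az
    ... | inj₂ za | refl = ⊥-elim (z≢x (arc-source-unique za xa))

  module _ {a c x z : Fin n} (2[2r+1]≤n : suc (r + r) + suc (r + r) ≤ n) (c∈S : c ∈ S)
           (1≤h : 1 ≤ h) (h≤1+r : h ≤ suc r) (1≤j : 1 ≤ j) (j≤r : j ≤ r) where

    private
      short : (h + j) + (h + j) ≤ n
      short = ≤-trans (+-mono-≤ h+j≤ h+j≤) 2[2r+1]≤n
        where h+j≤ = +-mono-≤ h≤1+r j≤r

    separated-from-behind : Arc c h a → Arc a j x → Arc z j a → Separated n r S x z
    separated-from-behind ca ax za = separated-by-distances c∈S 1≤h 1≤j (∣m-n∣≤r h≤1+r 1≤j j≤r)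
      (cdist-trans short ca ax) (cdist-converging short ca za)

    separated-from-ahead : Arc a h c → Arc a j x → Arc z j a → Separated n r S x z
    separated-from-ahead ac ax za =
      separated-sym (separated-by-distances c∈S 1≤h 1≤j (∣m-n∣≤r h≤1+r 1≤j j≤r) cz (cdist-diverging short ac ax))
      where
      open ≡-Reasoning
      cz : cdist n c z ≡ h + j
      cz = begin
        cdist n c z   ≡⟨ cdist-comm c z ⟩
        cdist n z c   ≡⟨ cdist-trans (subst (λ k → k + k ≤ n) (+-comm h j) short) za ac ⟩
        j + h         ≡⟨ +-comm j h ⟩
        h + j         ∎

  -- Landmarks placed in blocks

  ∣p∪q∣≤∣p∣+∣q∣ : ∀ {n} (p q : Subset n) → ∣ p ∪ q ∣ ≤ ∣ p ∣ + ∣ q ∣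
  ∣p∪q∣≤∣p∣+∣q∣ []          []          = z≤n
  ∣p∪q∣≤∣p∣+∣q∣ (true ∷ p)  (true ∷ q)  =
    s≤s (≤-trans (∣p∪q∣≤∣p∣+∣q∣ p q) (+-monoʳ-≤ ∣ p ∣ (n≤1+n ∣ q ∣)))
  ∣p∪q∣≤∣p∣+∣q∣ (true ∷ p)  (false ∷ q) = s≤s (∣p∪q∣≤∣p∣+∣q∣ p q)
  ∣p∪q∣≤∣p∣+∣q∣ (false ∷ p) (true ∷ q)  =
    ≤-trans (s≤s (∣p∪q∣≤∣p∣+∣q∣ p q)) (≤-reflexive (sym (+-suc ∣ p ∣ ∣ q ∣)))
  ∣p∪q∣≤∣p∣+∣q∣ (false ∷ p) (false ∷ q) = ∣p∪q∣≤∣p∣+∣q∣ p q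

  ⁅_⁆ℕ : ∀ {n} → ℕ → Subset n
  ⁅_⁆ℕ {n} k with k <? n
  ... | yes k<n = ⁅ fromℕ< k<n ⁆
  ... | no  _   = ⊥

  ∣⁅k⁆ℕ∣≤1 : ∀ {n} k → ∣ ⁅_⁆ℕ {n} k ∣ ≤ 1
  ∣⁅k⁆ℕ∣≤1 {n} k with k <? n
  ... | yes k<n = ≤-reflexive (∣⁅x⁆∣≡1 (fromℕ< k<n))
  ... | no  _   = ≤-trans (≤-reflexive (∣⊥∣≡0 n)) z≤n

  ∣⁅j⁆ℕ∪⁅k⁆ℕ∣≤2 : ∀ n j k → ∣ ⁅_⁆ℕ {n} j ∪ ⁅ k ⁆ℕ ∣ ≤ 2
  ∣⁅j⁆ℕ∪⁅k⁆ℕ∣≤2 n j k =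
    ≤-trans (∣p∪q∣≤∣p∣+∣q∣ (⁅_⁆ℕ {n} j) ⁅ k ⁆ℕ)
            (+-mono-≤ (∣⁅k⁆ℕ∣≤1 {n} j) (∣⁅k⁆ℕ∣≤1 {n} k))

  ∈⁅toℕ⁆ℕ : ∀ {n} (v : Fin n) → v ∈ ⁅ toℕ v ⁆ℕ
  ∈⁅toℕ⁆ℕ {n} v with toℕ v <? n
  ... | yes v<n = subst (λ w → v ∈ ⁅ w ⁆) (toℕ-injective (sym (toℕ-fromℕ< v<n))) (x∈⁅x⁆ v)
  ... | no  v≮n = ⊥-elim (v≮n (toℕ<n v))

  module Blocks (n r : ℕ) (G H : ℕ → ℕ) where

    start : ℕ → ℕ
    start zero    = 0
    start (suc b) = start b + (G b + H b)

    middle : ℕ → ℕ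
    middle b = start b + G b

    landmarks : ℕ → Subset n
    landmarks zero    = ⊥
    landmarks (suc b) = landmarks b ∪ (⁅ start b ⁆ℕ ∪ ⁅ middle b ⁆ℕ)

    ∣landmarks∣≤ : ∀ m → ∣ landmarks m ∣ ≤ 2 * m
    ∣landmarks∣≤ zero    = ≤-reflexive (∣⊥∣≡0 n)
    ∣landmarks∣≤ (suc b) = begin
      ∣ landmarks b ∪ pair ∣         ≤⟨ ∣p∪q∣≤∣p∣+∣q∣ (landmarks b) pair ⟩
      ∣ landmarks b ∣ + ∣ pair ∣     ≤⟨ +-mono-≤ (∣landmarks∣≤ b) (∣⁅j⁆ℕ∪⁅k⁆ℕ∣≤2 n _ _) ⟩
      2 * b + 2                     ≡⟨ trans (+-comm (2 * b) 2) (sym (*-suc 2 b)) ⟩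
      2 * suc b                     ∎
      where
      open ≤-Reasoning hiding (start)
      pair : Subset n
      pair = ⁅ start b ⁆ℕ ∪ ⁅ middle b ⁆ℕ

    ∈landmarks : ∀ {b m} → b < m → (v : Fin n) → toℕ v ≡ start b ⊎ toℕ v ≡ middle b → v ∈ landmarks m
    ∈landmarks {b} {suc m} b<1+m v at with m≤n⇒m<n∨m≡n (s≤s⁻¹ b<1+m)
    ... | inj₁ b<m = x∈p∪q⁺ (inj₁ (∈landmarks b<m v at))
    ... | inj₂ refl with at
    ...   | inj₁ v≡start  = x∈p∪q⁺ (inj₂ (x∈p∪q⁺ (inj₁ (subst (λ k → v ∈ ⁅ k ⁆ℕ) v≡start (∈⁅toℕ⁆ℕ v)))))
    ...   | inj₂ v≡middle = x∈p∪q⁺ (inj₂ (x∈p∪q⁺ (inj₂ (subst (λ k → v ∈ ⁅ k ⁆ℕ) v≡middle (∈⁅toℕ⁆ℕ v)))))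

    start-mono : ∀ {b c} → b ≤ c → start b ≤ start c
    start-mono {c = zero}  z≤n = ≤-refl
    start-mono {c = suc c} b≤1+c with m≤n⇒m<n∨m≡n b≤1+c
    ... | inj₁ b<1+c = ≤-trans (start-mono (s≤s⁻¹ b<1+c)) (m≤m+n (start c) (G c + H c))
    ... | inj₂ refl  = ≤-refl

    middle+H≡start : ∀ b → middle b + H b ≡ start (suc b)
    middle+H≡start b = +-assoc (start b) (G b) (H b)

    locate : ∀ m k → k < start m → ∃ λ b → b < m × ∃ λ j → start b + j ≡ k × j < G b + H b
    locate (suc m) k k<end with k <? start m
    ... | yes k<start = let b , b<m , rest = locate m k k<start in b , m≤n⇒m≤1+n b<m , rest
    ... | no  k≮start = m , ≤-refl , k ∸ start m , m+[n∸m]≡n start≤k ,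
                        +-cancelˡ-< (start m) _ _ (subst (_< start (suc m)) (sym (m+[n∸m]≡n start≤k)) k<end)
      where start≤k = ≮⇒≥ k≮start

    record Admissible (m : ℕ) : Set where
      field
        covers  : start m ≡ n
        G-pos   : ∀ {b} → b < m → 1 ≤ G b
        G-bound : ∀ {b} → b < m → G b ≤ suc (r + r)
        H-pos   : ∀ {b} → b < m → 1 ≤ H b
        H-bound : ∀ {b} → b < m → H b ≤ suc r

    module _ {m : ℕ} (adm : Admissible m) (2[2r+1]≤n : suc (r + r) + suc (r + r) ≤ n) where
      open Admissible adm

      private

        short : ∀ {j} → j ≤ r → j + j ≤ n
        short j≤r = ≤-trans (+-mono-≤ j≤ j≤) 2[2r+1]≤n
          where j≤ = ≤-trans j≤r (≤-trans (m≤m+n _ _) (n≤1+n _))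

        m-1 = m ∸ 1

        1≤m : 1 ≤ m
        1≤m = ≰⇒> λ m≤0 → <⇒≢ (≤-trans (s≤s z≤n) 2[2r+1]≤n) (trans (cong start (sym (n≤0⇒n≡0 m≤0))) covers)

        arc-at : ∀ {u v : Fin n} {p q d} → toℕ u ≡ p → toℕ v ≡ q → p + d ≡ q → Arc u d v
        arc-at refl refl = direct

        wrapped-at : ∀ {u v : Fin n} {p q d} → toℕ u ≡ p → toℕ v ≡ q → p + d ≡ q + n → Arc u d v
        wrapped-at refl refl = wrapped

      start<n : ∀ {b} → b < m → start b < n
      start<n {b} b<m = <-≤-trans (m<m+n (start b) (≤-trans (G-pos b<m) (m≤m+n (G b) (H b))))
                                  (subst (start (suc b) ≤_) covers (start-mono b<m))

      middle<n : ∀ {b} → b < m → middle b < n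
      middle<n {b} b<m = <-≤-trans (m<m+n (middle b) (H-pos b<m))
                                   (subst₂ _≤_ (sym (middle+H≡start b)) covers (start-mono b<m))

      startPt : ∀ {b} → b < m → Fin n
      startPt b<m = fromℕ< (start<n b<m)

      middlePt : ∀ {b} → b < m → Fin n
      middlePt b<m = fromℕ< (middle<n b<m)

      startPt∈S : ∀ {b} (b<m : b < m) → startPt b<m ∈ landmarks m
      startPt∈S b<m = ∈landmarks b<m _ (inj₁ (toℕ-fromℕ< (start<n b<m)))

      middlePt∈S : ∀ {b} (b<m : b < m) → middlePt b<m ∈ landmarks m
      middlePt∈S b<m = ∈landmarks b<m _ (inj₂ (toℕ-fromℕ< (middle<n b<m)))

      previous-landmark : ∀ {b} (b<m : b < m) →
                          ∃ λ c → c ∈ landmarks m × ∃ λ h → 1 ≤ h × h ≤ suc r × Arc c h (startPt b<m)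
      previous-landmark {zero} 0<m = middlePt last<m , middlePt∈S last<m , H m-1 , H-pos last<m , H-bound last<m ,
        wrapped-at (toℕ-fromℕ< (middle<n last<m)) (toℕ-fromℕ< (start<n 0<m))
                   (trans (middle+H≡start m-1) (trans (cong start (m+[n∸m]≡n 1≤m)) covers))
        where last<m = ≤-reflexive (m+[n∸m]≡n 1≤m)
      previous-landmark {suc b} b+1<m = middlePt b<m , middlePt∈S b<m , H b , H-pos b<m , H-bound b<m ,
        arc-at (toℕ-fromℕ< (middle<n b<m)) (toℕ-fromℕ< (start<n b+1<m)) (middle+H≡start b)
        where b<m = <-trans (n<1+n b) b+1<m

      next-landmark : ∀ {b} (b<m : b < m) → ∃ λ c → c ∈ landmarks m × Arc (middlePt b<m) (H b) c
      next-landmark {b} b<m with m≤n⇒m<n∨m≡n b<m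
      ... | inj₁ b+1<m = startPt b+1<m , startPt∈S b+1<m ,
        arc-at (toℕ-fromℕ< (middle<n b<m)) (toℕ-fromℕ< (start<n b+1<m)) (middle+H≡start b)
      ... | inj₂ b+1≡m = startPt 1≤m , startPt∈S 1≤m ,
        wrapped-at (toℕ-fromℕ< (middle<n b<m)) (toℕ-fromℕ< (start<n 1≤m))
                   (trans (middle+H≡start b) (trans (cong start b+1≡m) covers))

      anchored-after-middle : ∀ {b} (b<m : b < m) (x : Fin n) i → middle b + i ≡ toℕ x → i < H b →
                              Anchored n r (landmarks m) x
      anchored-after-middle b<m x zero at _ =
        landmark-anchored (∈landmarks b<m x (inj₂ (trans (sym at) (+-identityʳ _))))
      anchored-after-middle {b} b<m x (suc i) at i<H with next-landmark b<m
      ... | c , c∈S , ac = anchored-ahead (middlePt∈S b<m) i≤r (short i≤r) ax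
        λ z za → separated-from-ahead 2[2r+1]≤n c∈S (H-pos b<m) (H-bound b<m) (s≤s z≤n) i≤r ac ax za
        where
        i≤r = s≤s⁻¹ (≤-trans i<H (H-bound b<m))
        ax = arc-at (toℕ-fromℕ< (middle<n b<m)) refl at

      anchored-after-start : ∀ {b} (b<m : b < m) (x : Fin n) j → start b + j ≡ toℕ x → j < G b →
                             Anchored n r (landmarks m) x
      anchored-after-start b<m x zero at _ =
        landmark-anchored (∈landmarks b<m x (inj₁ (trans (sym at) (+-identityʳ _))))
      anchored-after-start {b} b<m x (suc j) at j<G with suc j ≤? r
      ... | yes j≤r with previous-landmark b<m
      ...   | c , c∈S , h , 1≤h , h≤1+r , ca = anchored-ahead (startPt∈S b<m) j≤r (short j≤r) ax
          λ z za → separated-from-behind 2[2r+1]≤n c∈S 1≤h h≤1+r (s≤s z≤n) j≤r ca ax za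
        where ax = arc-at (toℕ-fromℕ< (start<n b<m)) refl at
      anchored-after-start {b} b<m x (suc j) at j<G | no j≰r with next-landmark b<m
      ...   | c , c∈S , ac = anchored-behind (middlePt∈S b<m) i≤r (short i≤r) xa
          λ z az → separated-sym (separated-from-ahead 2[2r+1]≤n c∈S (H-pos b<m) (H-bound b<m) 1≤i i≤r ac az xa)
        where
        i = G b ∸ suc j
        1≤i : 1 ≤ i
        1≤i = m<n⇒0<n∸m j<G
        i≤r : i ≤ r
        i≤r = ≤-trans (∸-mono (G-bound b<m) (≰⇒> j≰r)) (≤-reflexive (m+n∸m≡n r r))
        xa = arc-at refl (toℕ-fromℕ< (middle<n b<m)) (begin
          toℕ x + i                 ≡⟨ cong (_+ i) at ⟨
          start b + suc j + i       ≡⟨ +-assoc (start b) (suc j) i ⟩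
          start b + (suc j + i)     ≡⟨ cong (start b +_) (m+[n∸m]≡n (<⇒≤ j<G)) ⟩
          middle b                  ∎)
          where open ≡-Reasoning

      landmarks-resolving : Resolving n r (landmarks m)
      landmarks-resolving = anchored⇒resolving anchored
        where
        anchored : ∀ x → Anchored n r (landmarks m) x
        anchored x with locate m (toℕ x) (subst (toℕ x <_) (sym covers) (toℕ<n x))
        ... | b , b<m , j , at , j<G+H with j <? G b
        ...   | yes j<G = anchored-after-start b<m x j at j<G
        ...   | no  j≮G = anchored-after-middle b<m x (j ∸ G b) at′ i<H
          where
          G≤j = ≮⇒≥ j≮G
          at′ : middle b + (j ∸ G b) ≡ toℕ x
          at′ = trans (+-assoc (start b) (G b) (j ∸ G b)) (trans (cong (start b +_) (m+[n∸m]≡n G≤j)) at)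
          i<H : j ∸ G b < H b
          i<H = +-cancelˡ-< (G b) _ _ (subst (_< G b + H b) (sym (m+[n∸m]≡n G≤j)) j<G+H)

  -- Full blocks have gaps 2r and r+1; the last one takes the remainder of n ∸ 2 plus 2, so that
  -- both of its gaps are positive.
  module RegularBlocks (n r : ℕ) where

    L : ℕ
    L = suc (r + r + r)

    q ρ : ℕ
    q = (n ∸ 2) / L
    ρ = (n ∸ 2) % L

    G H : ℕ → ℕ
    G b with b <? q
    ... | yes _ = r + r
    ... | no  _ = suc (ρ ∸ r)
    H b with b <? q
    ... | yes _ = suc r
    ... | no  _ = suc (r ⊓ ρ)

    open Blocks n r G H

    start≡b*L : ∀ b → b ≤ q → start b ≡ b * L
    start≡b*L zero    _     = refl
    start≡b*L (suc b) b<q with b <? q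
    ... | yes _   = begin
      start b + (r + r + suc r)   ≡⟨ cong₂ _+_ (start≡b*L b (<⇒≤ b<q)) (+-suc (r + r) r) ⟩
      b * L + L                   ≡⟨ +-comm (b * L) L ⟩
      suc b * L                   ∎
      where open ≡-Reasoning
    ... | no b≮q = contradiction b<q b≮q

    last-block : G q + H q ≡ suc (suc ρ)
    last-block with q <? q
    ... | yes q<q = contradiction q<q (<-irrefl refl)
    ... | no  _   = begin
      suc (ρ ∸ r) + suc (r ⊓ ρ)   ≡⟨ cong suc (+-suc (ρ ∸ r) (r ⊓ ρ)) ⟩
      suc (suc (ρ ∸ r + r ⊓ ρ))   ≡⟨ cong (suc ∘ suc) (+-comm (ρ ∸ r) (r ⊓ ρ)) ⟩
      suc (suc (r ⊓ ρ + (ρ ∸ r))) ≡⟨ cong (suc ∘ suc) (m⊓n+n∸m≡n r ρ) ⟩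
      suc (suc ρ)                 ∎
      where open ≡-Reasoning

    covers : 2 ≤ n → start (suc q) ≡ n
    covers 2≤n = begin
      start q + (G q + H q)   ≡⟨ cong₂ _+_ (start≡b*L q ≤-refl) last-block ⟩
      q * L + (2 + ρ)         ≡⟨ +-comm (q * L) (2 + ρ) ⟩
      2 + (ρ + q * L)         ≡⟨ cong (2 +_) (m≡m%n+[m/n]*n (n ∸ 2) L) ⟨
      2 + (n ∸ 2)             ≡⟨ m+[n∸m]≡n 2≤n ⟩
      n                       ∎
      where open ≡-Reasoning

    admissible : 1 ≤ r → 2 ≤ n → Admissible (suc q)
    admissible 1≤r 2≤n = record
      { covers  = covers 2≤n
      ; G-pos   = λ {b} _ → G-pos b
      ; G-bound = λ {b} _ → G-bound b
      ; H-pos   = λ {b} _ → H-pos b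
      ; H-bound = λ {b} _ → H-bound b
      }
      where
      G-pos : ∀ b → 1 ≤ G b
      G-pos b with b <? q
      ... | yes _ = ≤-trans 1≤r (m≤m+n r r)
      ... | no  _ = s≤s z≤n
      G-bound : ∀ b → G b ≤ suc (r + r)
      G-bound b with b <? q
      ... | yes _ = n≤1+n (r + r)
      ... | no  _ = s≤s (≤-trans (∸-monoˡ-≤ r (s≤s⁻¹ (m%n<n (n ∸ 2) L))) (≤-reflexive (m+n∸n≡m (r + r) r)))
      H-pos : ∀ b → 1 ≤ H b
      H-pos b with b <? q
      ... | yes _ = s≤s z≤n
      ... | no  _ = s≤s z≤n
      H-bound : ∀ b → H b ≤ suc r
      H-bound b with b <? q
      ... | yes _ = ≤-refl
      ... | no  _ = s≤s (m⊓n≤m r ρ)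

  small-resolving-set : ∀ {n r} → 1 ≤ r → suc (r + r) + suc (r + r) ≤ n →
    ∃ λ (S : Subset n) → Resolving n r S × ∣ S ∣ ≤ 2 * suc ((n ∸ 2) / suc (r + r + r))
  small-resolving-set {n} {r} 1≤r 2[2r+1]≤n =
    landmarks (suc q) , landmarks-resolving (admissible 1≤r 2≤n) 2[2r+1]≤n , ∣landmarks∣≤ (suc q)
    where
    open RegularBlocks n r
    open Blocks n r G H
    2≤n : 2 ≤ n
    2≤n = ≤-trans (s≤s (≤-trans (s≤s z≤n) (m≤n+m (suc (r + r)) (r + r)))) 2[2r+1]≤n

  -- Counting codes

  rank : {S : Subset n} {v : Fin n} → v ∈ S → Fin ∣ S ∣
  rank                     here        = Fin.zero
  rank {S = true  ∷ _}     (there v∈S) = Fin.suc (rank v∈S)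
  rank {S = false ∷ _}     (there v∈S) = rank v∈S

  rank-injective : {S : Subset n} {v w : Fin n} (v∈S : v ∈ S) (w∈S : w ∈ S) →
                   rank v∈S ≡ rank w∈S → v ≡ w
  rank-injective                 here        here        _  = refl
  rank-injective {S = true ∷ _}  (there v∈S) (there w∈S) eq =
    cong Fin.suc (rank-injective v∈S w∈S (Fin.suc-injective eq))
  rank-injective {S = false ∷ _} (there v∈S) (there w∈S) eq = cong Fin.suc (rank-injective v∈S w∈S eq)

  -- ahead d and behind d locate a vertex at distance d on either side of the landmark;
  -- alone d is a vertex at distance d that no other landmark sees.
  Slot : ℕ → Set
  Slot r = Fin 3 × Fin (suc r)

  pattern ahead  d = 0F , d
  pattern behind d = 1F , d
  pattern alone  d = 2F , d

  Code : ℕ → ℕ → Set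
  Code k r = Fin k × Slot r ⊎ Fin 2

  join-injective : ∀ m n → Injective _≡_ _≡_ (join m n)
  join-injective m n {i} {j} eq = trans (sym (splitAt-join m n i)) (trans (cong (splitAt m) eq) (splitAt-join m n j))

  splitAt-injective : ∀ m {n} → Injective _≡_ _≡_ (splitAt m {n})
  splitAt-injective m {n} {i} {j} eq = trans (sym (join-splitAt m n i)) (trans (cong (join m n) eq) (join-splitAt m n j))

  pack : Fin k × Slot r → Fin (k * (3 * suc r))
  pack (i , t , d) = combine i (combine t d)

  pack-injective : Injective _≡_ _≡_ (pack {k} {r})
  pack-injective {x = i , t , d} {i′ , t′ , d′} eq with combine-injective i _ i′ _ eq
  ... | refl , td≡ with combine-injective t d t′ d′ td≡
  ...   | refl , refl = refl

  encode : Code k r → Fin (k * (3 * suc r) + 2)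
  encode = join _ 2 ∘ map₁ pack

  encode-injective : Injective _≡_ _≡_ (encode {k} {r})
  encode-injective {x = inj₁ c} {inj₁ c′} eq =
    cong inj₁ (pack-injective (inj₁-injective (join-injective _ 2 {inj₁ (pack c)} {inj₁ (pack c′)} eq)))
  encode-injective {x = inj₁ c} {inj₂ e′} eq with () ← join-injective _ 2 {inj₁ (pack c)} {inj₂ e′} eq
  encode-injective {x = inj₂ e} {inj₁ c′} eq with () ← join-injective _ 2 {inj₂ e} {inj₁ (pack c′)} eq
  encode-injective {x = inj₂ e} {inj₂ e′} eq = cong inj₂ (inj₂-injective (join-injective _ 2 {inj₂ e} {inj₂ e′} eq))

  nearSlot : (v x : Fin n) → cdist n v x ≤ r → Slot r
  nearSlot v x le with arc-cdist v x
  ... | inj₁ _ = ahead  (fromℕ< (s≤s le))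
  ... | inj₂ _ = behind (fromℕ< (s≤s le))

  nearSlot-injective : {v x x′ : Fin n} (le : cdist n v x ≤ r) (le′ : cdist n v x′ ≤ r) →
                   nearSlot v x le ≡ nearSlot v x′ le′ → x ≡ x′
  nearSlot-injective {n} {v = v} {x} {x′} le le′ eq with arc-cdist v x | arc-cdist v x′ | eq
  ... | inj₁ vx | inj₁ vx′ | e = arc-target-unique vx (subst (λ d → Arc v d x′) (sym (same-distance (cong proj₂ e))) vx′)
    where same-distance = fromℕ<-injective (cdist n v x) (cdist n v x′) (s≤s le) (s≤s le′)
  ... | inj₂ xv | inj₂ x′v | e = arc-source-unique xv (subst (λ d → Arc x′ d v) (sym (same-distance (cong proj₂ e))) x′v)
    where same-distance = fromℕ<-injective (cdist n v x) (cdist n v x′) (s≤s le) (s≤s le′)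

  nearSlot≢alone : {v x : Fin n} (le : cdist n v x ≤ r) (d : Fin (suc r)) → nearSlot v x le ≢ alone d
  nearSlot≢alone {v = v} {x} le d eq with arc-cdist v x | eq
  ... | inj₁ _ | ()
  ... | inj₂ _ | ()

  module _ {n r : ℕ} {S : Subset n} (resolving : Resolving n r S) where

    private
      far⇒truncated : ∀ {m} → r < m → m ⊓ suc r ≡ suc r
      far⇒truncated = m≥n⇒m⊓n≡n

      same-truncations⇒≡ : ∀ {x x′} → (∀ {u} → u ∈ S → cdist-r n r u x ≡ cdist-r n r u x′) → x ≡ x′
      same-truncations⇒≡ {x} {x′} same with x Fin.≟ x′
      ... | yes x≡x′ = x≡x′
      ... | no  x≢x′ = let u , u∈S , differ = resolving x x′ x≢x′ in ⊥-elim (differ (same u∈S))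

    data Sight (x : Fin n) : Set where
      unseen     : (∀ {v} → v ∈ S → r < cdist n v x) → Sight x
      seen-once  : ∀ {v} → v ∈ S → cdist n v x ≤ r → (∀ {w} → w ∈ S → w ≢ v → r < cdist n w x) → Sight x
      seen-twice : ∀ {v w} → v ∈ S → w ∈ S → v ≢ w → cdist n v x ≤ r → cdist n w x ≤ r → Sight x

    sight : ∀ x → Sight x
    sight x with any? (λ v → (v ∈? S) ×-dec (cdist n v x ≤? r))
    ... | no nobody = unseen (λ v∈S → ≰⇒> (λ le → nobody (_ , v∈S , le)))
    ... | yes (v , v∈S , le) with any? (λ w → (w ∈? S) ×-dec ¬? (w Fin.≟ v) ×-dec (cdist n w x ≤? r))
    ...   | yes (w , w∈S , w≢v , le′) = seen-twice v∈S w∈S (w≢v ∘ sym) le le′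
    ...   | no  nobody-else = seen-once v∈S le (λ w∈S w≢v → ≰⇒> (λ le′ → nobody-else (_ , w∈S , w≢v , le′)))

    data CodeOf (x : Fin n) : Code ∣ S ∣ r → Set where
      unseen : (∀ {v} → v ∈ S → r < cdist n v x) → ∀ i → CodeOf x (inj₂ i)
      near   : ∀ {v} (v∈S : v ∈ S) (le : cdist n v x ≤ r) → CodeOf x (inj₁ (rank v∈S , nearSlot v x le))
      sole   : ∀ {v} (v∈S : v ∈ S) (le : cdist n v x ≤ r) → (∀ {w} → w ∈ S → w ≢ v → r < cdist n w x) →
               CodeOf x (inj₁ (rank v∈S , alone (fromℕ< (s≤s le))))

    codeOf-injective : ∀ {x x′ c c′} → CodeOf x c → CodeOf x′ c′ → c ≡ c′ → x ≡ x′
    codeOf-injective (unseen far _) (unseen far′ _) _ =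
      same-truncations⇒≡ λ u∈S → trans (far⇒truncated (far u∈S)) (sym (far⇒truncated (far′ u∈S)))
    codeOf-injective (near v∈S le) (near v′∈S le′) eq
      with refl ← rank-injective v∈S v′∈S (cong proj₁ (inj₁-injective eq)) =
      nearSlot-injective le le′ (cong proj₂ (inj₁-injective eq))
    codeOf-injective (near _ le) (sole _ _ _) eq = ⊥-elim (nearSlot≢alone le _ (cong proj₂ (inj₁-injective eq)))
    codeOf-injective (sole _ _ _) (near _ le′) eq = ⊥-elim (nearSlot≢alone le′ _ (sym (cong proj₂ (inj₁-injective eq))))
    codeOf-injective {x} {x′} (sole {v} v∈S le only) (sole v′∈S le′ only′) eq
      with refl ← rank-injective v∈S v′∈S (cong proj₁ (inj₁-injective eq)) = same-truncations⇒≡ same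
      where
      same-distance : cdist n v x ≡ cdist n v x′
      same-distance = fromℕ<-injective _ _ (s≤s le) (s≤s le′) (cong (proj₂ ∘ proj₂) (inj₁-injective eq))
      same : ∀ {u} → u ∈ S → cdist-r n r u x ≡ cdist-r n r u x′
      same {u} u∈S with u Fin.≟ v
      ... | yes refl = cong (_⊓ suc r) same-distance
      ... | no  u≢v  = trans (far⇒truncated (only u∈S u≢v)) (sym (far⇒truncated (only′ u∈S u≢v)))

    codes : ∀ {x} → Sight x → (Code ∣ S ∣ r) × (Code ∣ S ∣ r)
    codes (unseen _) = inj₂ 0F , inj₂ 1F
    codes {x} (seen-once {v} v∈S le _) =
      inj₁ (rank v∈S , nearSlot v x le) , inj₁ (rank v∈S , alone (fromℕ< (s≤s le)))
    codes {x} (seen-twice {v} {w} v∈S w∈S _ le le′) =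
      inj₁ (rank v∈S , nearSlot v x le) , inj₁ (rank w∈S , nearSlot w x le′)

    codes-valid : ∀ {x} (s : Sight x) → CodeOf x (proj₁ (codes s)) × CodeOf x (proj₂ (codes s))
    codes-valid (unseen far)                      = unseen far 0F , unseen far 1F
    codes-valid (seen-once v∈S le only)           = near v∈S le , sole v∈S le only
    codes-valid (seen-twice v∈S w∈S _ le le′)     = near v∈S le , near w∈S le′

    codes-distinct : ∀ {x} (s : Sight x) → proj₁ (codes s) ≢ proj₂ (codes s)
    codes-distinct (unseen _) ()
    codes-distinct (seen-once _ le _) eq = nearSlot≢alone le _ (cong proj₂ (inj₁-injective eq))
    codes-distinct (seen-twice v∈S w∈S v≢w _ _) eq = v≢w (rank-injective v∈S w∈S (cong proj₁ (inj₁-injective eq)))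

    code : Fin n ⊎ Fin n → Code ∣ S ∣ r
    code (inj₁ x) = proj₁ (codes (sight x))
    code (inj₂ x) = proj₂ (codes (sight x))

    code-injective : Injective _≡_ _≡_ code
    code-injective {inj₁ x} {inj₁ x′} eq =
      cong inj₁ (codeOf-injective (proj₁ (codes-valid (sight x))) (proj₁ (codes-valid (sight x′))) eq)
    code-injective {inj₂ x} {inj₂ x′} eq =
      cong inj₂ (codeOf-injective (proj₂ (codes-valid (sight x))) (proj₂ (codes-valid (sight x′))) eq)
    code-injective {inj₁ x} {inj₂ x′} eq
      with refl ← codeOf-injective (proj₁ (codes-valid (sight x))) (proj₂ (codes-valid (sight x′))) eq =
      ⊥-elim (codes-distinct (sight x) eq)
    code-injective {inj₂ x} {inj₁ x′} eq
      with refl ← codeOf-injective (proj₂ (codes-valid (sight x))) (proj₁ (codes-valid (sight x′))) eq =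
      ⊥-elim (codes-distinct (sight x) (sym eq))

    n+n≤∣S∣*3[1+r]+2 : n + n ≤ ∣ S ∣ * (3 * suc r) + 2
    n+n≤∣S∣*3[1+r]+2 = injective⇒≤ {f = encode ∘ code ∘ splitAt n}
      (splitAt-injective n ∘ code-injective ∘ encode-injective)

  -- Minimal resolving sets and the threshold dimension

  module _ {P : ℕ → Set} (P? : ∀ d → Dec (P d)) where

    private
      search : ∀ k → (∀ {d} → d < k → ¬ P d) ⊎ (∃ λ d → P d × ∀ d′ → P d′ → d ≤ d′)
      search zero = inj₁ λ ()
      search (suc k) with search k
      ... | inj₂ least = inj₂ least
      ... | inj₁ none with P? k
      ...   | yes Pk = inj₂ (k , Pk , λ d′ Pd′ → ≮⇒≥ λ d′<k → none d′<k Pd′)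
      ...   | no ¬Pk = inj₁ λ d<1+k → [ none , (λ { refl → ¬Pk }) ]′ (m≤n⇒m<n∨m≡n (s≤s⁻¹ d<1+k))

    least-witness : ∀ {k} → P k → ∃ λ d → P d × ∀ d′ → P d′ → d ≤ d′
    least-witness {k} Pk with search (suc k)
    ... | inj₁ none  = ⊥-elim (none ≤-refl Pk)
    ... | inj₂ least = least

  resolving? : ∀ n r (S : Subset n) → Dec (Resolving n r S)
  resolving? n r S = all? λ x → all? λ y → ¬? (x Fin.≟ y) →-dec
    any? λ v → (v ∈? S) ×-dec ¬? (cdist-r n r v x ≟ cdist-r n r v y)

  HasResolvingSetOfSize : (n r d : ℕ) → Set
  HasResolvingSetOfSize n r d = ∃ λ (S : Subset n) → Resolving n r S × ∣ S ∣ ≡ d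

  dim-exists : ∀ {n r} {S : Subset n} → Resolving n r S → ∃ λ d → IsDim n r d × d ≤ ∣ S ∣
  dim-exists {n} {r} {S} resolving
    with d , witness , least ← least-witness {P = HasResolvingSetOfSize n r}
           (λ d → anySubset? λ S → resolving? n r S ×-dec (∣ S ∣ ≟ d)) (S , resolving , refl) =
    d , (witness , λ S′ res′ → least ∣ S′ ∣ (S′ , res′ , refl)) , least ∣ S ∣ (S , resolving , refl)

  private
    4mn≤[m+n]²-ordered : ∀ {m n} → m ≤ n → 4 * (m * n) ≤ (m + n) * (m + n)
    4mn≤[m+n]²-ordered {m} m≤n with k , refl ← m≤n⇒∃[o]m+o≡n m≤n =
      ≤-trans (m≤m+n _ (k * k)) (≤-reflexive (square m k))
      where
      square : ∀ m k → 4 * (m * (m + k)) + k * k ≡ (m + (m + k)) * (m + (m + k))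
      square = solve-∀

  4mn≤[m+n]² : ∀ m n → 4 * (m * n) ≤ (m + n) * (m + n)
  4mn≤[m+n]² m n with ≤-total m n
  ... | inj₁ m≤n = 4mn≤[m+n]²-ordered m≤n
  ... | inj₂ n≤m = subst₂ _≤_ (cong (4 *_) (*-comm n m)) (cong (λ x → x * x) (+-comm n m)) (4mn≤[m+n]²-ordered n≤m)

  thDim⇒8n≤3t²+12t+8 : ∀ {n t} → IsThDim n t → 8 * n ≤ 3 * (t * t) + 12 * t + 8
  thDim⇒8n≤3t²+12t+8 {n} ((r , d , ((S , resolving , refl) , _) , refl) , _) = begin
    8 * n                                       ≡⟨ double n ⟩
    4 * (n + n)                                 ≤⟨ *-monoʳ-≤ 4 (n+n≤∣S∣*3[1+r]+2 resolving) ⟩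
    4 * (d * (3 * suc r) + 2)                   ≡⟨ expand d r ⟩
    3 * (4 * (r * d)) + 12 * d + 8              ≤⟨ +-monoˡ-≤ 8 (+-mono-≤ (*-monoʳ-≤ 3 (4mn≤[m+n]² r d))
                                                                         (*-monoʳ-≤ 12 (m≤n+m d r))) ⟩
    3 * ((r + d) * (r + d)) + 12 * (r + d) + 8  ∎
    where
    open ≤-Reasoning
    double : ∀ n → 8 * n ≡ 4 * (n + n)
    double = solve-∀
    expand : ∀ d r → 4 * (d * (3 * suc r) + 2) ≡ 3 * (4 * (r * d)) + 12 * d + 8
    expand = solve-∀

  private
    2[4s+1]≤6s² : ∀ {s} → 2 ≤ s → suc ((s + s) + (s + s)) + suc ((s + s) + (s + s)) ≤ 6 * (s * s)
    2[4s+1]≤6s² 2≤s with u , refl ← m≤n⇒∃[o]m+o≡n 2≤s =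
      ≤-trans (m≤m+n _ (6 + 16 * u + 6 * (u * u))) (≤-reflexive (room u))
      where
      room : ∀ u → suc ((2 + u + (2 + u)) + (2 + u + (2 + u))) + suc ((2 + u + (2 + u)) + (2 + u + (2 + u)))
                   + (6 + 16 * u + 6 * (u * u)) ≡ 6 * ((2 + u) * (2 + u))
      room = solve-∀

    6[s+1]²≤[s+2][6s+1]+2 : ∀ {s} → 2 ≤ s → 6 * (suc s * suc s) ≤ (s + 2) * suc ((s + s) + (s + s) + (s + s)) + 2
    6[s+1]²≤[s+2][6s+1]+2 2≤s with u , refl ← m≤n⇒∃[o]m+o≡n 2≤s =
      ≤-trans (m≤m+n _ u) (≤-reflexive (sym (blocks u)))
      where
      blocks : ∀ u → (2 + u + 2) * suc ((2 + u + (2 + u)) + (2 + u + (2 + u)) + (2 + u + (2 + u))) + 2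
                     ≡ 6 * (suc (2 + u) * suc (2 + u)) + u
      blocks = solve-∀

  thDim≤r+∣S∣ : ∀ {n t r} {S : Subset n} → IsThDim n t → Resolving n r S → t ≤ r + ∣ S ∣
  thDim≤r+∣S∣ {r = r} (_ , minimal) resolving with d , isDim , d≤∣S∣ ← dim-exists resolving =
    ≤-trans (minimal r d isDim) (+-monoʳ-≤ r d≤∣S∣)

  thDim≤4s+4 : ∀ {n t s} → 2 ≤ s → 6 * (s * s) ≤ n → n < 6 * (suc s * suc s) → IsThDim n t → t ≤ 4 * s + 4
  thDim≤4s+4 {n} {t} {s} 2≤s lo hi thDim =
    let S , resolving , ∣S∣≤ = small-resolving-set (≤-trans (≤-trans (s≤s z≤n) 2≤s) (m≤m+n s s)) room in
    begin
      t                                  ≤⟨ thDim≤r+∣S∣ thDim resolving ⟩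
      (s + s) + ∣ S ∣                    ≤⟨ +-monoʳ-≤ (s + s) (≤-trans ∣S∣≤ (*-monoʳ-≤ 2 blocks≤)) ⟩
      (s + s) + 2 * (s + 2)              ≡⟨ total s ⟩
      4 * s + 4                          ∎
    where
    open ≤-Reasoning
    room : suc ((s + s) + (s + s)) + suc ((s + s) + (s + s)) ≤ n
    room = ≤-trans (2[4s+1]≤6s² 2≤s) lo
    total : ∀ s → (s + s) + 2 * (s + 2) ≡ 4 * s + 4
    total = solve-∀
    blocks≤ : suc ((n ∸ 2) / suc ((s + s) + (s + s) + (s + s))) ≤ s + 2
    blocks≤ = m<n*o⇒m/o<n (+-cancelʳ-< 2 (n ∸ 2) _ (begin-strict
      n ∸ 2 + 2    ≡⟨ m∸n+n≡m (≤-trans (+-mono-≤ (s≤s z≤n) (s≤s z≤n)) room) ⟩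
      n            <⟨ hi ⟩
      _            ≤⟨ 6[s+1]²≤[s+2][6s+1]+2 2≤s ⟩
      _            ∎))

  -- Asymptotics

  scaled-square-root : ∀ c .{{_ : NonZero c}} n → ∃ λ s → c * (s * s) ≤ n × n < c * (suc s * suc s)
  scaled-square-root c zero = 0 , ≤-reflexive (*-zeroʳ c) , subst (0 <_) (sym (*-identityʳ c)) (>-nonZero⁻¹ c)
  scaled-square-root c (suc n) with scaled-square-root c n
  ... | s , lo , hi with c * (suc s * suc s) ≤? suc n
  ...   | yes lo′ = suc s , lo′ , <-≤-trans (s≤s hi) (*-monoʳ-< c (*-mono-< (n<1+n (suc s)) (n<1+n (suc s))))
  ...   | no  lo′ = s , m≤n⇒m≤1+n lo , ≰⇒> lo′

  private
    Q[12s+14]≤6s² : ∀ {Q s} → 2 * Q + 3 ≤ s → Q * (12 * s + 14) ≤ 6 * (s * s)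
    Q[12s+14]≤6s² {Q} 2Q+3≤s with k , refl ← m≤n⇒∃[o]m+o≡n 2Q+3≤s =
      ≤-trans (m≤m+n _ (54 + 22 * Q + 36 * k + 12 * (Q * k) + 6 * (k * k))) (≤-reflexive (slack Q k))
      where
      slack : ∀ Q k → Q * (12 * (2 * Q + 3 + k) + 14) + (54 + 22 * Q + 36 * k + 12 * (Q * k) + 6 * (k * k))
                      ≡ 6 * ((2 * Q + 3 + k) * (2 * Q + 3 + k))
      slack = solve-∀

  module _ {Q n t s : ℕ} (t≤4s+4 : t ≤ 4 * s + 4) (Q[12s+14]≤n : Q * (12 * s + 14) ≤ n) where
    open ≤-Reasoning

    Q*8n≤Q*3t²+8n : 8 * n ≤ 3 * (t * t) + 12 * t + 8 → Q * (8 * n) ≤ Q * (3 * (t * t)) + 8 * n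
    Q*8n≤Q*3t²+8n 8n≤ = begin
      Q * (8 * n)                                  ≤⟨ *-monoʳ-≤ Q 8n≤ ⟩
      Q * (3 * (t * t) + 12 * t + 8)               ≡⟨ split Q t ⟩
      Q * (3 * (t * t)) + 4 * (Q * (3 * t + 2))    ≤⟨ +-monoʳ-≤ (Q * (3 * (t * t))) (*-monoʳ-≤ 4 Q[3t+2]≤n) ⟩
      Q * (3 * (t * t)) + 4 * n                    ≤⟨ +-monoʳ-≤ (Q * (3 * (t * t))) (*-monoˡ-≤ n (m≤m+n 4 4)) ⟩
      Q * (3 * (t * t)) + 8 * n                    ∎
      where
      split : ∀ Q t → Q * (3 * (t * t) + 12 * t + 8) ≡ Q * (3 * (t * t)) + 4 * (Q * (3 * t + 2))
      split = solve-∀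
      linear : ∀ s → 3 * (4 * s + 4) + 2 ≡ 12 * s + 14
      linear = solve-∀
      Q[3t+2]≤n : Q * (3 * t + 2) ≤ n
      Q[3t+2]≤n = ≤-trans (*-monoʳ-≤ Q (≤-trans (+-monoˡ-≤ 2 (*-monoʳ-≤ 3 t≤4s+4)) (≤-reflexive (linear s))))
                          Q[12s+14]≤n

    Q*3t²≤Q*8n+8n : 6 * (s * s) ≤ n → Q * (3 * (t * t)) ≤ Q * (8 * n) + 8 * n
    Q*3t²≤Q*8n+8n 6s²≤n = begin
      Q * (3 * (t * t))                              ≤⟨ *-monoʳ-≤ Q 3t²≤ ⟩
      Q * (8 * (6 * (s * s)) + 8 * (12 * s + 6))     ≤⟨ *-monoʳ-≤ Q (+-monoˡ-≤ (8 * (12 * s + 6)) (*-monoʳ-≤ 8 6s²≤n)) ⟩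
      Q * (8 * n + 8 * (12 * s + 6))                 ≡⟨ split Q n s ⟩
      Q * (8 * n) + 8 * (Q * (12 * s + 6))           ≤⟨ +-monoʳ-≤ (Q * (8 * n)) (*-monoʳ-≤ 8 Q[12s+6]≤n) ⟩
      Q * (8 * n) + 8 * n                            ∎
      where
      square : ∀ s → 3 * ((4 * s + 4) * (4 * s + 4)) ≡ 8 * (6 * (s * s)) + 8 * (12 * s + 6)
      square = solve-∀
      split : ∀ Q n s → Q * (8 * n + 8 * (12 * s + 6)) ≡ Q * (8 * n) + 8 * (Q * (12 * s + 6))
      split = solve-∀
      3t²≤ : 3 * (t * t) ≤ 8 * (6 * (s * s)) + 8 * (12 * s + 6)
      3t²≤ = ≤-trans (*-monoʳ-≤ 3 (*-mono-≤ t≤4s+4 t≤4s+4)) (≤-reflexive (square s))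
      Q[12s+6]≤n : Q * (12 * s + 6) ≤ n
      Q[12s+6]≤n = ≤-trans (*-monoʳ-≤ Q (+-monoʳ-≤ (12 * s) (m≤m+n 6 8))) Q[12s+14]≤n

  threshold : ℕ → ℕ
  threshold Q = 6 * ((2 * Q + 3) * (2 * Q + 3))

  thDim-relative-bounds : ∀ Q {n t} → threshold Q ≤ n → IsThDim n t →
    Q * (8 * n) ≤ Q * (3 * (t * t)) + 8 * n × Q * (3 * (t * t)) ≤ Q * (8 * n) + 8 * n
  thDim-relative-bounds Q {n} {t} large thDim with s , 6s²≤n , n<6[s+1]² ← scaled-square-root 6 n =
    Q*8n≤Q*3t²+8n {Q} {n} {t} {s} t≤4s+4 Q[12s+14]≤n (thDim⇒8n≤3t²+12t+8 thDim) ,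
    Q*3t²≤Q*8n+8n {Q} {n} {t} {s} t≤4s+4 Q[12s+14]≤n 6s²≤n
    where
    2Q+3≤s : 2 * Q + 3 ≤ s
    2Q+3≤s = ≮⇒≥ λ s<2Q+3 → <⇒≱ n<6[s+1]² (≤-trans (*-monoʳ-≤ 6 (*-mono-≤ s<2Q+3 s<2Q+3)) large)
    t≤4s+4 : t ≤ 4 * s + 4
    t≤4s+4 = thDim≤4s+4 (≤-trans (≤-trans (n≤1+n 2) (m≤n+m 3 (2 * Q))) 2Q+3≤s) 6s²≤n n<6[s+1]² thDim
    Q[12s+14]≤n : Q * (12 * s + 14) ≤ n
    Q[12s+14]≤n = ≤-trans (Q[12s+14]≤6s² {Q} 2Q+3≤s) 6s²≤n

-- Relative errors over ℚ

module _ where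
  open import Data.Integer as ℤ using (+_; +[1+_])
  import Data.Integer.Properties as ℤ
  open import Data.Nat as ℕ using (ℕ; suc)
  import Data.Nat.Properties as ℕ
  open import Data.Rational
    using (ℚ; mkℚ; *<*; 0ℚ; 1ℚ; _+_; _-_; _*_; -_; _≤_; _<_; toℚᵘ; ↧ₙ_; Positive; positive; nonNegative)
  open import Data.Rational.Properties
  open import Data.Rational.Solver using (module +-*-Solver)
  open import Data.Rational.Unnormalised as ℚᵘ using (ℚᵘ; mkℚᵘ; *≡*; *≤*)
  import Data.Rational.Unnormalised.Properties as ℚᵘ
  open import Relation.Binary.PropositionalEquality

  private
    ℕ→ℚᵘ : ℕ → ℚᵘ
    ℕ→ℚᵘ k = mkℚᵘ (+ k) 0

    toℚᵘ-ℕ→ℚ : ∀ k → toℚᵘ (ℕ→ℚ k) ℚᵘ.≃ ℕ→ℚᵘ k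
    toℚᵘ-ℕ→ℚ k = toℚᵘ-fromℚᵘ (ℕ→ℚᵘ k)

  ℕ→ℚ-+ : ∀ a b → ℕ→ℚ (a ℕ.+ b) ≡ ℕ→ℚ a + ℕ→ℚ b
  ℕ→ℚ-+ a b = toℚᵘ-injective (begin-equality
    toℚᵘ (ℕ→ℚ (a ℕ.+ b))                   ≃⟨ toℚᵘ-ℕ→ℚ (a ℕ.+ b) ⟩
    ℕ→ℚᵘ (a ℕ.+ b)                          ≃⟨ *≡* (cong (ℤ._* + 1) (trans (ℤ.pos-+ a b)
                                                 (sym (cong₂ ℤ._+_ (ℤ.*-identityʳ (+ a)) (ℤ.*-identityʳ (+ b)))))) ⟩
    ℕ→ℚᵘ a ℚᵘ.+ ℕ→ℚᵘ b                      ≃⟨ ℚᵘ.+-cong (toℚᵘ-ℕ→ℚ a) (toℚᵘ-ℕ→ℚ b) ⟨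
    toℚᵘ (ℕ→ℚ a) ℚᵘ.+ toℚᵘ (ℕ→ℚ b)          ≃⟨ toℚᵘ-homo-+ (ℕ→ℚ a) (ℕ→ℚ b) ⟨
    toℚᵘ (ℕ→ℚ a + ℕ→ℚ b)                    ∎)
    where open ℚᵘ.≤-Reasoning

  ℕ→ℚ-* : ∀ a b → ℕ→ℚ (a ℕ.* b) ≡ ℕ→ℚ a * ℕ→ℚ b
  ℕ→ℚ-* a b = toℚᵘ-injective (begin-equality
    toℚᵘ (ℕ→ℚ (a ℕ.* b))                   ≃⟨ toℚᵘ-ℕ→ℚ (a ℕ.* b) ⟩
    ℕ→ℚᵘ (a ℕ.* b)                          ≃⟨ *≡* (cong (ℤ._* + 1) (ℤ.pos-* a b)) ⟩
    ℕ→ℚᵘ a ℚᵘ.* ℕ→ℚᵘ b                      ≃⟨ ℚᵘ.*-cong (toℚᵘ-ℕ→ℚ a) (toℚᵘ-ℕ→ℚ b) ⟨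
    toℚᵘ (ℕ→ℚ a) ℚᵘ.* toℚᵘ (ℕ→ℚ b)          ≃⟨ toℚᵘ-homo-* (ℕ→ℚ a) (ℕ→ℚ b) ⟨
    toℚᵘ (ℕ→ℚ a * ℕ→ℚ b)                    ∎)
    where open ℚᵘ.≤-Reasoning

  ℕ→ℚ-mono-≤ : ∀ {a b} → a ℕ.≤ b → ℕ→ℚ a ≤ ℕ→ℚ b
  ℕ→ℚ-mono-≤ {a} {b} a≤b = toℚᵘ-cancel-≤ (begin
    toℚᵘ (ℕ→ℚ a)   ≃⟨ toℚᵘ-ℕ→ℚ a ⟩
    ℕ→ℚᵘ a         ≤⟨ *≤* (ℤ.*-monoʳ-≤-nonNeg (+ 1) (ℤ.+≤+ a≤b)) ⟩
    ℕ→ℚᵘ b         ≃⟨ toℚᵘ-ℕ→ℚ b ⟨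
    toℚᵘ (ℕ→ℚ b)   ∎)
    where open ℚᵘ.≤-Reasoning

  -- For ε = (1+p)/(1+d) the product ↧ε · ε is 1+p; d≤[p+d[1+p]]*1 is that bound in normal form.
  1≤↧ε*ε : ∀ ε → 0ℚ < ε → 1ℚ ≤ ℕ→ℚ (↧ₙ ε) * ε
  1≤↧ε*ε ε@(mkℚ +[1+ p ] d _) _ = toℚᵘ-cancel-≤ (begin
    toℚᵘ 1ℚ                                   ≤⟨ *≤* (ℤ.+≤+ (ℕ.s≤s d≤[p+d[1+p]]*1)) ⟩
    ℕ→ℚᵘ (suc d) ℚᵘ.* mkℚᵘ +[1+ p ] d          ≃⟨ ℚᵘ.*-cong (toℚᵘ-ℕ→ℚ (suc d)) (ℚᵘ.≃-refl {mkℚᵘ +[1+ p ] d}) ⟨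
    toℚᵘ (ℕ→ℚ (suc d)) ℚᵘ.* toℚᵘ ε              ≃⟨ toℚᵘ-homo-* (ℕ→ℚ (suc d)) ε ⟨
    toℚᵘ (ℕ→ℚ (suc d) * ε)                      ∎)
    where
    open ℚᵘ.≤-Reasoning
    d≤[p+d[1+p]]*1 : d ℕ.+ 0 ℕ.+ 0 ℕ.≤ (p ℕ.+ d ℕ.* suc p) ℕ.* 1
    d≤[p+d[1+p]]*1 = subst₂ ℕ._≤_ (sym (trans (ℕ.+-identityʳ _) (ℕ.+-identityʳ d))) (sym (ℕ.*-identityʳ _))
                            (ℕ.≤-trans (ℕ.m≤m*n d (suc p)) (ℕ.m≤n+m (d ℕ.* suc p) p))
  1≤↧ε*ε (mkℚ (+ 0) _ _) (*<* (ℤ.+<+ ()))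
  1≤↧ε*ε (mkℚ ℤ.-[1+ _ ] _ _) (*<* ())

  module _ {q ε : ℚ} .{{_ : Positive q}} (0≤ε : 0ℚ ≤ ε) (1≤qε : 1ℚ ≤ q * ε) {a b : ℚ} (0≤a : 0ℚ ≤ a) where
    open +-*-Solver
    open ≤-Reasoning

    private
      a≤qεa : a ≤ (q * ε) * a
      a≤qεa = begin
        a               ≡⟨ *-identityˡ a ⟨
        1ℚ * a          ≤⟨ *-monoʳ-≤-nonNeg a {{nonNegative 0≤a}} 1≤qε ⟩
        (q * ε) * a     ∎

    [1-ε]²a≤b : ε ≤ 1ℚ → q * a ≤ q * b + a → ((1ℚ - ε) * (1ℚ - ε)) * a ≤ b
    [1-ε]²a≤b ε≤1 qa≤qb+a = begin
      ((1ℚ - ε) * (1ℚ - ε)) * a   ≤⟨ *-monoʳ-≤-nonNeg a {{nonNegative 0≤a}} u²≤u ⟩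
      (1ℚ - ε) * a                ≤⟨ *-cancelˡ-≤-pos q q[ua]≤qb ⟩
      b                           ∎
      where
      u = 1ℚ - ε
      0≤u : 0ℚ ≤ u
      0≤u = begin
        0ℚ        ≡⟨ +-inverseʳ 1ℚ ⟨
        1ℚ - 1ℚ   ≤⟨ +-monoʳ-≤ 1ℚ (neg-antimono-≤ ε≤1) ⟩
        u         ∎
      u≤1 : u ≤ 1ℚ
      u≤1 = begin
        u         ≤⟨ +-monoʳ-≤ 1ℚ (neg-antimono-≤ 0≤ε) ⟩
        1ℚ - 0ℚ   ≡⟨ +-identityʳ 1ℚ ⟩
        1ℚ        ∎
      u²≤u : u * u ≤ u
      u²≤u = begin
        u * u     ≤⟨ *-monoˡ-≤-nonNeg u {{nonNegative 0≤u}} u≤1 ⟩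
        u * 1ℚ    ≡⟨ *-identityʳ u ⟩
        u         ∎
      q[ua]≤qb : q * (u * a) ≤ q * b
      q[ua]≤qb = begin
        q * (u * a)           ≡⟨ solve 3 (λ q ε a → q :* ((con 1ℚ :- ε) :* a) := q :* a :- (q :* ε) :* a) refl q ε a ⟩
        q * a - (q * ε) * a   ≤⟨ +-monoʳ-≤ (q * a) (neg-antimono-≤ a≤qεa) ⟩
        q * a - a             ≤⟨ +-monoˡ-≤ (- a) qa≤qb+a ⟩
        (q * b + a) - a       ≡⟨ solve 2 (λ x a → (x :+ a) :- a := x) refl (q * b) a ⟩
        q * b                 ∎

    b≤[1+ε]²a : q * b ≤ q * a + a → b ≤ ((1ℚ + ε) * (1ℚ + ε)) * a
    b≤[1+ε]²a qb≤qa+a = begin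
      b                            ≤⟨ *-cancelˡ-≤-pos q qb≤q[wa] ⟩
      w * a                        ≤⟨ *-monoʳ-≤-nonNeg a {{nonNegative 0≤a}} w≤w² ⟩
      (w * w) * a                  ∎
      where
      w = 1ℚ + ε
      1≤w : 1ℚ ≤ w
      1≤w = begin
        1ℚ         ≡⟨ +-identityʳ 1ℚ ⟨
        1ℚ + 0ℚ    ≤⟨ +-monoʳ-≤ 1ℚ 0≤ε ⟩
        w          ∎
      w≤w² : w ≤ w * w
      w≤w² = begin
        w          ≡⟨ *-identityʳ w ⟨
        w * 1ℚ     ≤⟨ *-monoˡ-≤-nonNeg w {{nonNegative (≤-trans (<⇒≤ (positive⁻¹ 1ℚ)) 1≤w)}} 1≤w ⟩
        w * w      ∎
      qb≤q[wa] : q * b ≤ q * (w * a)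
      qb≤q[wa] = begin
        q * b                  ≤⟨ qb≤qa+a ⟩
        q * a + a              ≤⟨ +-monoʳ-≤ (q * a) a≤qεa ⟩
        q * a + (q * ε) * a    ≡⟨ solve 3 (λ q ε a → q :* a :+ (q :* ε) :* a := q :* ((con 1ℚ :+ ε) :* a)) refl q ε a ⟩
        q * (w * a)            ∎

  module _ (ε : ℚ) (0<ε : 0ℚ < ε) where

    private
      Q = ↧ₙ ε
      q = ℕ→ℚ Q

      1≤q : 1ℚ ≤ q
      1≤q = ℕ→ℚ-mono-≤ {1} {Q} (ℕ.s≤s ℕ.z≤n)

      instance
        q-positive : Positive q
        q-positive = positive (<-≤-trans (positive⁻¹ 1ℚ) 1≤q)

      0≤ℕ→ℚ : ∀ k → 0ℚ ≤ ℕ→ℚ k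
      0≤ℕ→ℚ k = ℕ→ℚ-mono-≤ {0} {k} ℕ.z≤n

      cast : ∀ {A B C} → Q ℕ.* A ℕ.≤ Q ℕ.* B ℕ.+ C → q * ℕ→ℚ A ≤ q * ℕ→ℚ B + ℕ→ℚ C
      cast {A} {B} {C} le =
        subst₂ _≤_ (ℕ→ℚ-* Q A) (trans (ℕ→ℚ-+ (Q ℕ.* B) C) (cong (_+ ℕ→ℚ C) (ℕ→ℚ-* Q B))) (ℕ→ℚ-mono-≤ le)

    [1-ε]²A≤B : ε ≤ 1ℚ → ∀ A B → Q ℕ.* A ℕ.≤ Q ℕ.* B ℕ.+ A → ((1ℚ - ε) * (1ℚ - ε)) * ℕ→ℚ A ≤ ℕ→ℚ B
    [1-ε]²A≤B ε≤1 A B le =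
      [1-ε]²a≤b {q} {ε} (<⇒≤ 0<ε) (1≤↧ε*ε ε 0<ε) (0≤ℕ→ℚ A) ε≤1 (cast {A} {B} {A} le)

    B≤[1+ε]²A : ∀ A B → Q ℕ.* B ℕ.≤ Q ℕ.* A ℕ.+ A → ℕ→ℚ B ≤ ((1ℚ + ε) * (1ℚ + ε)) * ℕ→ℚ A
    B≤[1+ε]²A A B le =
      b≤[1+ε]²a {q} {ε} (<⇒≤ 0<ε) (1≤↧ε*ε ε 0<ε) (0≤ℕ→ℚ A) (cast {B} {A} {A} le)

open import Data.Nat using (ℕ; _≤_)
open import Data.Product using (∃; _×_; _,_)
open import Data.Rational using (ℚ; 0ℚ; 1ℚ; _+_; _-_; _*_; _<_)
import Data.Rational as Q
open import Data.Rational.Properties using (<⇒≤)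

mainTheorem15 : ∀ (ε : ℚ) → 0ℚ < ε → ε < 1ℚ →
    ∃ λ (N : ℕ) → ∀ (n t : ℕ) → 3 ≤ n → N ≤ n → IsThDim n t →
      (((1ℚ - ε) * (1ℚ - ε)) * ℕ→ℚ (8 Data.Nat.* n) Q.≤ ℕ→ℚ (3 Data.Nat.* (t Data.Nat.* t)))
      × (ℕ→ℚ (3 Data.Nat.* (t Data.Nat.* t)) Q.≤ ((1ℚ + ε) * (1ℚ + ε)) * ℕ→ℚ (8 Data.Nat.* n))
mainTheorem15 ε 0<ε ε<1 = threshold (Q.↧ₙ ε) , λ n t _ large thDim →
  let lower , upper = thDim-relative-bounds (Q.↧ₙ ε) large thDim
  in [1-ε]²A≤B ε 0<ε (<⇒≤ ε<1) (8 Data.Nat.* n) (3 Data.Nat.* (t Data.Nat.* t)) lower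
   , B≤[1+ε]²A ε 0<ε (8 Data.Nat.* n) (3 Data.Nat.* (t Data.Nat.* t)) upper
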